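{- Let $n \ge 1$, $1 \le k \le n$, $\epsilon \ge 0$, and let $\mathbf{A} \in \{0,1\}^{m\times n}$ be an $\epsilon$-almost $k$-disjunct matrix. Then $\mathbf{A}$ is $\epsilon$-almost $k$-separable (with the same $\epsilon$ and $k$).
   Context: For a binary matrix $\mathbf{A}\in\{0,1\}^{m\times n}$, let $S_i\subseteq\{1,\dots,m\}$ denote the support of column $i$ (the set of rows in which column $i$ has a $1$), and for $\mathcal{K}\subseteq\{1,\dots,n\}$ let $S(\mathcal{K})=\bigcup_{i\in\mathcal{K}}S_i$. The matrix $\mathbf{A}$ is $\epsilon$-almost $k$-disjunct if for at most $\epsilon\binom nk$ sets $\mathcal{K}\subseteq\{1,\dots,n\}$ with $|\mathcal{K}|=k$ there exists a column $i\notin\mathcal{K}$ with $S_i\subseteq S(\mathcal{K})$. The matrix $\mathbf{A}$ is $\epsilon$-almost $k$-separable if for at most $\epsilon\binom nk$ sets $\mathcal{K}$ with $|\mathcal{K}|=k$ there exists another set $\mathcal{L}\ne\mathcal{K}$ with $|\mathcal{L}|=k$ and $S(\mathcal{L})=S(\mathcal{K})$.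
   Formalization: The parameter ε ranges over the nonnegative rationals. -}

module Defs where

open import Data.Bool using (Bool; true)
open import Data.Nat using (ℕ)
open import Data.Nat.Combinatorics using (_C_)
open import Data.Fin using (Fin)
open import Data.Fin.Subset using (Subset; _∈_; ∣_∣)
open import Data.List using (List; length)
import Data.List.Membership.Propositional as LM
open import Data.List.Relation.Unary.Unique.Propositional using (Unique)
open import Data.Integer using (+_)
open import Data.Rational using (ℚ; _/_; _*_; _≤_)
open import Data.Product using (Σ; ∃; _×_)
open import Relation.Binary.PropositionalEquality using (_≡_; _≢_)
open import Relation.Nullary using (¬_)
open import Function.Bundles using (_⇔_)

BinMatrix : ℕ → ℕ → Set
BinMatrix m n = Fin m → Fin n → Bool

InSupp : ∀ {m n} → BinMatrix m n → Fin n → Fin m → Set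
InSupp A i r = A r i ≡ true

InUnion : ∀ {m n} → BinMatrix m n → Subset n → Fin m → Set
InUnion A K r = ∃ λ i → (i ∈ K) × InSupp A i r

SuppSub : ∀ {m n} → BinMatrix m n → Fin n → Subset n → Set
SuppSub A i K = ∀ r → InSupp A i r → InUnion A K r

SameUnion : ∀ {m n} → BinMatrix m n → Subset n → Subset n → Set
SameUnion A L K = ∀ r → InUnion A L r ⇔ InUnion A K r

DisjBad : ∀ {m n} → BinMatrix m n → Subset n → Set
DisjBad A K = ∃ λ i → ¬ (i ∈ K) × SuppSub A i K

SepBad : ∀ {m n} → BinMatrix m n → ℕ → Subset n → Set
SepBad A k K = ∃ λ L → (∣ L ∣ ≡ k) × (L ≢ K) × SameUnion A L K

-- The number of k-subsets K of {1..n} satisfying P is at most x (a rational):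
-- there is a duplicate-free list containing all such K whose length is ≤ x.
AtMost : ∀ n → ℕ → (Subset n → Set) → ℚ → Set
AtMost n k P x =
  Σ (List (Subset n)) λ xs →
    Unique xs × (∀ K → ∣ K ∣ ≡ k → P K → K LM.∈ xs) × ((+ length xs) / 1 ≤ x)

AlmostDisjunct : ∀ {m n} → BinMatrix m n → ℕ → ℚ → Set
AlmostDisjunct {m} {n} A k ε = AtMost n k (DisjBad A) (ε * ((+ (n C k)) / 1))

AlmostSeparable : ∀ {m n} → BinMatrix m n → ℕ → ℚ → Set
AlmostSeparable {m} {n} A k ε = AtMost n k (SepBad A k) (ε * ((+ (n C k)) / 1))

-- A k-set K that is bad for separability is already bad for disjunctness:
-- if L ≠ K is another k-set with S(L) = S(K), then, having the same size,
-- L has a column i ∉ K, and S_i ⊆ S(L) = S(K).  So the list of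
-- disjunctness-bad k-sets also covers every separability-bad one.
module Submission where

open import Defs
open import Data.Nat using (ℕ; _≤_)
open import Data.Nat.Properties using (<-irrefl)
open import Data.Rational using (ℚ; 0ℚ)
import Data.Rational as Q
open import Data.Fin.Properties using (any?)
open import Data.Fin.Subset using (Subset; _∈_; _∉_; _⊆_; ∣_∣)
open import Data.Fin.Subset.Properties using (_∈?_; _⊆?_; ⊆-antisym; p⊂q⇒∣p∣<∣q∣)
open import Data.Empty using (⊥-elim)
open import Data.Product using (∃; _×_; _,_)
open import Relation.Binary.PropositionalEquality using (_≡_; _≢_; sym; trans)
open import Relation.Nullary using (¬_; yes; no)
open import Relation.Nullary.Decidable using (_×-dec_; ¬?; decidable-stable)
open import Relation.Nullary.Negation using (contradiction)
open import Function.Bundles using (Equivalence)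

module _ {n : ℕ} where

  ⊈⇒∃∈∖ : {p q : Subset n} → ¬ (p ⊆ q) → ∃ λ x → x ∈ p × x ∉ q
  ⊈⇒∃∈∖ {p} {q} p⊈q with any? (λ x → (x ∈? p) ×-dec ¬? (x ∈? q))
  ... | yes witness = witness
  ... | no none = ⊥-elim (p⊈q p⊆q)
    where
    p⊆q : p ⊆ q
    p⊆q {x} x∈p = decidable-stable (x ∈? q) (λ x∉q → none (x , x∈p , x∉q))

  ∣p∣≡∣q∣∧p⊆q⇒p≡q : {p q : Subset n} → ∣ p ∣ ≡ ∣ q ∣ → p ⊆ q → p ≡ q
  ∣p∣≡∣q∣∧p⊆q⇒p≡q {p} {q} ∣p∣≡∣q∣ p⊆q with q ⊆? p
  ... | yes q⊆p = ⊆-antisym p⊆q q⊆p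
  ... | no q⊈p = contradiction (p⊂q⇒∣p∣<∣q∣ (p⊆q , ⊈⇒∃∈∖ q⊈p)) (<-irrefl ∣p∣≡∣q∣)

  ∣p∣≡∣q∣∧p≢q⇒∃∈∖ : {p q : Subset n} → ∣ p ∣ ≡ ∣ q ∣ → p ≢ q → ∃ λ x → x ∈ p × x ∉ q
  ∣p∣≡∣q∣∧p≢q⇒∃∈∖ ∣p∣≡∣q∣ p≢q = ⊈⇒∃∈∖ (λ p⊆q → p≢q (∣p∣≡∣q∣∧p⊆q⇒p≡q ∣p∣≡∣q∣ p⊆q))

AtMost-mono : ∀ {n k x} {P Q : Subset n → Set} →
  (∀ K → ∣ K ∣ ≡ k → P K → Q K) → AtMost n k Q x → AtMost n k P x
AtMost-mono P⇒Q (xs , unique , covers , length≤x) =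
  xs , unique , (λ K ∣K∣≡k PK → covers K ∣K∣≡k (P⇒Q K ∣K∣≡k PK)) , length≤x

SepBad⇒DisjBad : ∀ {m n} (A : BinMatrix m n) {k} K → ∣ K ∣ ≡ k → SepBad A k K → DisjBad A K
SepBad⇒DisjBad A K ∣K∣≡k (L , ∣L∣≡k , L≢K , S[L]≡S[K])
  with ∣p∣≡∣q∣∧p≢q⇒∃∈∖ (trans ∣L∣≡k (sym ∣K∣≡k)) L≢K
... | i , i∈L , i∉K = i , i∉K , λ r r∈Sᵢ → Equivalence.to (S[L]≡S[K] r) (i , i∈L , r∈Sᵢ)

lemma1 : (m n k : ℕ) → 1 ≤ n → 1 ≤ k → k ≤ n → (ε : ℚ) → 0ℚ Q.≤ ε →
    (A : BinMatrix m n) → AlmostDisjunct A k ε → AlmostSeparable A k ε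
lemma1 m n k _ _ _ ε _ A = AtMost-mono (SepBad⇒DisjBad A)
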